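{- Let $\Gamma=(V,E)$ be an $n$-regular indexed multigraph and let $f,f'\in W(\Gamma,\mathbb{F})$. For $v\in V$ and $\ell\in[n]$, let $|\overline{(v,\ell)}|$ denote the cardinality of the equivalence class of $(v,\ell)$ under $\sim_E$, and let $M:=\max_{v\in V}\sum_{\ell\in[n]}\frac{1}{|\overline{(v,\ell)}|}$. Then \[\Delta_V(f,f')\geq\frac{|\overline{E}|}{M\,|V|}\,\Delta_H(f,f').\]
   Context: $\mathbb{F}$ is a finite field and $n\ge 1$ an integer; $[n]=\{1,\dots,n\}$. An $n$-regular indexed multigraph $\Gamma=(V,E)$ consists of a finite set $V$ and a map $E:V\times[n]\to V$ such that $E(E(v,\ell),\ell)=v$ for all $v\in V,\ell\in[n]$. The relation $\sim_E$ on $V\times[n]$ is defined by $(v,\ell)\sim_E(v',\ell')$ iff $\ell=\ell'$ and ($E(v,\ell)=v'$ or $v=v'$); $\overline{E}$ denotes the set of equivalence classes of $V\times[n]$ under $\sim_E$. $W(\Gamma,\mathbb{F})$ is the set of functions $f:V\times[n]\to\mathbb{F}$ such that $f(v,\ell)=f(v',\ell)$ whenever $(v,\ell)\sim_E(v',\ell)$. For $f,f'\in W(\Gamma,\mathbb{F})$: the relative vertex distance is $\Delta_V(f,f'):=\frac{1}{|V|}|\{v\in V: (f(v,1),\dots,f(v,n))\neq(f'(v,1),\dots,f'(v,n))\}|$, and the relative Hamming distance is $\Delta_H(f,f'):=\frac{1}{|\overline{E}|}|\{\overline{(v,\ell)}\in\overline{E}: f(v,\ell)\neq f'(v,\ell)\}|$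 (well defined since $f,f'$ are constant on classes). -}

module Defs where

open import Level using (0ℓ)
open import Data.Nat as ℕ using (ℕ; zero; suc)
open import Data.Integer as ℤ using (+_)
open import Data.Rational as ℚ using (ℚ; 0ℚ; 1ℚ)
open import Data.Rational.Properties as ℚP using ()
open import Data.Fin as Fin using (Fin)
open import Data.Bool using (Bool; true; false; _∧_; _∨_; not; if_then_else_)
open import Data.Product using (Σ; _×_; _,_; ∃)
open import Data.Sum using (_⊎_)
open import Relation.Binary.PropositionalEquality using (_≡_)
open import Relation.Binary.Definitions using (DecidableEquality)
open import Relation.Nullary using (¬_; yes; no; Dec)
open import Relation.Nullary.Decidable using (⌊_⌋; _×-dec_; _⊎-dec_)
open import Algebra.Core using (Op₁; Op₂)
open import Algebra.Structures using (IsCommutativeRing)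
open import Function.Bundles using (_↔_)
import Data.Vec as Vec
import Data.Vec.Properties as Vec

-- Finite fields (the field structure is carried but not used by the
-- statement; only decidable equality of the carrier matters).

record FiniteField : Set₁ where
  field
    Carrier : Set
    _+_ _*_ : Op₂ Carrier
    -_      : Op₁ Carrier
    0# 1#   : Carrier
    isCommutativeRing : IsCommutativeRing _≡_ _+_ _*_ -_ 0# 1#
    0≢1     : ¬ (0# ≡ 1#)
    inverse : ∀ x → ¬ (x ≡ 0#) → ∃ λ y → (x * y) ≡ 1#
    _≟_     : DecidableEquality Carrier
    size    : ℕ
    enum    : Fin size ↔ Carrier

-- n-regular indexed multigraphs.  V = Fin numV, [n] = Fin n (0-based).

record IndexedMultigraph (n : ℕ) : Set where
  field
    numV  : ℕ
    E     : Fin numV → Fin n → Fin numV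
    invol : ∀ v ℓ → E (E v ℓ) ℓ ≡ v

sumFin : ∀ {k} → (Fin k → ℕ) → ℕ
sumFin {zero}  g = 0
sumFin {suc k} g = g Fin.zero ℕ.+ sumFin (λ i → g (Fin.suc i))

sumFinℚ : ∀ {k} → (Fin k → ℚ) → ℚ
sumFinℚ {zero}  g = 0ℚ
sumFinℚ {suc k} g = g Fin.zero ℚ.+ sumFinℚ (λ i → g (Fin.suc i))

-- maximum of nonnegative rationals over Fin k (seed 0; equals the true
-- maximum when k ≥ 1 and all values are ≥ 0)
maxFinℚ : ∀ {k} → (Fin k → ℚ) → ℚ
maxFinℚ {zero}  g = 0ℚ
maxFinℚ {suc k} g = g Fin.zero ℚ.⊔ maxFinℚ (λ i → g (Fin.suc i))

countFin : ∀ {k} → (Fin k → Bool) → ℕ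
countFin P = sumFin (λ i → if P i then 1 else 0)

-- 1 / k as a rational (convention 1/0 := 0; never used since classes are nonempty)
recipℕ : ℕ → ℚ
recipℕ zero    = 0ℚ
recipℕ (suc k) = + 1 ℚ./ suc k

-- p / q with the convention p / 0 := 0 (never used in the theorem)
_÷ₛ_ : ℚ → ℚ → ℚ
p ÷ₛ q with q ℚP.≟ 0ℚ
... | yes _ = 0ℚ
... | no q≢0 = ℚ._÷_ p q {{ℚ.≢-nonZero q≢0}}

module _ {n : ℕ} (Γ : IndexedMultigraph n) where
  open IndexedMultigraph Γ

  V : Set
  V = Fin numV

  _∼E_ : V × Fin n → V × Fin n → Set
  (v , ℓ) ∼E (v' , ℓ') = (ℓ ≡ ℓ') × (E v ℓ ≡ v' ⊎ v ≡ v')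

  ∼E? : ∀ p q → Dec (p ∼E q)
  ∼E? (v , ℓ) (v' , ℓ') = (ℓ Fin.≟ ℓ') ×-dec ((E v ℓ Fin.≟ v') ⊎-dec (v Fin.≟ v'))

  countPairs : (V → Fin n → Bool) → ℕ
  countPairs P = sumFin (λ v → countFin (P v))

  -- lexicographic strict order on V × [n] (used to pick the least element
  -- of each equivalence class as its representative)
  _<lex_ : V × Fin n → V × Fin n → Bool
  (w , k) <lex (v , ℓ) = (Fin.toℕ w ℕ.<ᵇ Fin.toℕ v) ∨ (⌊ w Fin.≟ v ⌋ ∧ (Fin.toℕ k ℕ.<ᵇ Fin.toℕ ℓ))

  isRep : V → Fin n → Bool
  isRep v ℓ = countPairs (λ w k → ((w , k) <lex (v , ℓ)) ∧ ⌊ ∼E? (w , k) (v , ℓ) ⌋) ℕ.≡ᵇ 0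

  numClasses : ℕ
  numClasses = countPairs isRep

  classSize : V → Fin n → ℕ
  classSize v ℓ = countPairs (λ w k → ⌊ ∼E? (v , ℓ) (w , k) ⌋)

  M : ℚ
  M = maxFinℚ (λ v → sumFinℚ (λ ℓ → recipℕ (classSize v ℓ)))

  record W (F : FiniteField) : Set where
    open FiniteField F using (Carrier)
    field
      fun   : V → Fin n → Carrier
      const : ∀ v v' ℓ → (v , ℓ) ∼E (v' , ℓ) → fun v ℓ ≡ fun v' ℓ

  module _ {F : FiniteField} where
    open FiniteField F using (Carrier; _≟_)
    open W

    vertexDiffers : W F → W F → V → Bool
    vertexDiffers f f' v =
      not ⌊ Vec.≡-dec _≟_ (Vec.tabulate (fun f v)) (Vec.tabulate (fun f' v)) ⌋

    ΔV : (f f' : W F) → .{{ℕ.NonZero numV}} → ℚ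
    ΔV f f' = + countFin (vertexDiffers f f') ℚ./ numV

    numDiffClasses : W F → W F → ℕ
    numDiffClasses f f' = countPairs (λ v ℓ → isRep v ℓ ∧ not ⌊ fun f v ℓ ≟ fun f' v ℓ ⌋)

    ΔH : W F → W F → ℚ
    ΔH f f' = (+ numDiffClasses f f' ℚ./ 1) ÷ₛ (+ numClasses ℚ./ 1)

-- For a fixed index ℓ the map v ↦ E v ℓ is an involution of V, and the ∼_E-class of (v , ℓ)
-- is its orbit {(v , ℓ) , (E v ℓ , ℓ)}, of size 1 or 2.  Counting the classes on which f and f'
-- differ by their representatives is therefore the same as summing, over all pairs (v , ℓ) on
-- which they differ, the weight 1 / |class|: an orbit of size 2 is met twice with weight ½.
-- Grouping this sum by vertices, a vertex on which f and f' agree contributes 0 and any other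
-- vertex contributes at most M, so the number of differing classes is at most M times the
-- number of differing vertices; normalising both sides gives the inequality.
module Submission where

open import Defs
open import Data.Nat as ℕ using (ℕ; NonZero)
open import Data.Integer using (+_)
open import Data.Rational as ℚ using (ℚ; _≤_; _*_)
open IndexedMultigraph

open import Data.Nat using (zero; suc; _<ᵇ_)
import Data.Nat.Properties as ℕP
open import Algebra.Properties.CommutativeSemigroup ℕP.+-commutativeSemigroup using (interchange)
import Data.Integer as ℤ
import Data.Integer.Properties as ℤP
open import Data.Rational using (_+_; 0ℚ; 1ℚ; ½; 1/_)
import Data.Rational.Properties as ℚP
import Data.Rational.Unnormalised as ℚᵘ
import Data.Rational.Unnormalised.Properties as ℚᵘP
open import Data.Rational.Solver using (module +-*-Solver)
open import Data.Fin as Fin using (Fin; toℕ; _≟_)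
import Data.Fin.Properties as FinP
open import Data.Fin.Permutation using (permutation)
open import Data.Bool using (Bool; true; false; _∧_; _∨_; not; if_then_else_; T)
import Data.Bool.Properties as BoolP
open import Data.Product using (_×_; _,_)
open import Data.Sum using (_⊎_; inj₁; inj₂)
open import Data.Empty using (⊥-elim)
open import Relation.Binary.PropositionalEquality
open import Relation.Binary using (tri<; tri≈; tri>)
open import Relation.Nullary using (¬_; yes; no; Dec; does)
open import Relation.Nullary.Decidable using (⌊_⌋; isYes≗does; dec-true; dec-false; fromWitnessFalse; toWitnessFalse)
import Algebra.Properties.CommutativeMonoid.Sum as CommutativeMonoidSum
import Data.Vec as Vec
import Data.Vec.Properties as VecP
open import Function using (_∘_)

ι : ℕ → ℚ
ι k = + k ℚ./ 1

χ : Bool → ℚ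
χ b = if b then 1ℚ else 0ℚ

<ᵇ-irrefl : ∀ m → (m <ᵇ m) ≡ false
<ᵇ-irrefl m = dec-false (m ℕP.<? m) (ℕP.<-irrefl refl)

≡ᵇ0-false : ∀ {m} → 1 ℕ.≤ m → (m ℕ.≡ᵇ 0) ≡ false
≡ᵇ0-false {suc m} _ = refl

toℚᵘ-ι : ∀ k → ℚ.toℚᵘ (ι k) ℚᵘ.≃ ℚᵘ.mkℚᵘ (+ k) 0
toℚᵘ-ι k = ℚP.toℚᵘ-fromℚᵘ (ℚᵘ.mkℚᵘ (+ k) 0)

ι-+ : ∀ a b → ι (a ℕ.+ b) ≡ ι a + ι b
ι-+ a b = ℚP.toℚᵘ-injective (begin
  ℚ.toℚᵘ (ι (a ℕ.+ b))                     ≈⟨ toℚᵘ-ι (a ℕ.+ b) ⟩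
  ℚᵘ.mkℚᵘ (+ (a ℕ.+ b)) 0                  ≈⟨ ℚᵘ.*≡* (cong (ℤ._* + 1) (cong₂ ℤ._+_
                                                (sym (ℤP.*-identityʳ (+ a))) (sym (ℤP.*-identityʳ (+ b))))) ⟩
  ℚᵘ.mkℚᵘ (+ a) 0 ℚᵘ.+ ℚᵘ.mkℚᵘ (+ b) 0     ≈⟨ ℚᵘP.+-cong (toℚᵘ-ι a) (toℚᵘ-ι b) ⟨
  ℚ.toℚᵘ (ι a) ℚᵘ.+ ℚ.toℚᵘ (ι b)           ≈⟨ ℚP.toℚᵘ-homo-+ (ι a) (ι b) ⟨
  ℚ.toℚᵘ (ι a + ι b)                       ∎)
  where open ℚᵘP.≃-Reasoning

/-*-cancel : ∀ k d .{{_ : NonZero d}} → (+ k ℚ./ d) * ι d ≡ ι k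
/-*-cancel k (suc d-1) = ℚP.toℚᵘ-injective (begin
  ℚ.toℚᵘ ((+ k ℚ./ suc d-1) * ι (suc d-1))                  ≈⟨ ℚP.toℚᵘ-homo-* (+ k ℚ./ suc d-1) (ι (suc d-1)) ⟩
  ℚ.toℚᵘ (+ k ℚ./ suc d-1) ℚᵘ.* ℚ.toℚᵘ (ι (suc d-1))        ≈⟨ ℚᵘP.*-cong (ℚP.toℚᵘ-fromℚᵘ (ℚᵘ.mkℚᵘ (+ k) d-1))
                                                                             (toℚᵘ-ι (suc d-1)) ⟩
  ℚᵘ.mkℚᵘ (+ k) d-1 ℚᵘ.* ℚᵘ.mkℚᵘ (+ suc d-1) 0              ≈⟨ ℚᵘ.*≡* (trans (ℤP.*-identityʳ (+ k ℤ.* + suc d-1))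
                                                                 (cong (λ t → + k ℤ.* + t) (sym (ℕP.*-identityʳ (suc d-1))))) ⟩
  ℚᵘ.mkℚᵘ (+ k) 0                                          ≈⟨ toℚᵘ-ι k ⟨
  ℚ.toℚᵘ (ι k)                                             ∎)
  where open ℚᵘP.≃-Reasoning

/-nonNeg : ∀ k d .{{_ : NonZero d}} → 0ℚ ≤ + k ℚ./ d
/-nonNeg k d = ℚP.nonNegative⁻¹ (+ k ℚ./ d) {{ℚP.normalize-nonNeg k d}}

÷ₛ-zeroʳ : ∀ p {q} → q ≡ 0ℚ → p ÷ₛ q ≡ 0ℚ
÷ₛ-zeroʳ p {q} q≡0 with q ℚP.≟ 0ℚ
... | yes _   = refl
... | no q≢0 = ⊥-elim (q≢0 q≡0)

÷ₛ-≢0 : ∀ p {q} (q≢0 : ¬ q ≡ 0ℚ) → p ÷ₛ q ≡ p * (1/ q) {{ℚ.≢-nonZero q≢0}}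
÷ₛ-≢0 p {q} q≢0 with q ℚP.≟ 0ℚ
... | yes q≡0 = ⊥-elim (q≢0 q≡0)
... | no _    = refl

open +-*-Solver

-- If c or p is 0, the convention x ÷ₛ 0 = 0 makes the left-hand side 0.
÷ₛ-*-÷ₛ-≤ : ∀ c d {p q} → 0ℚ ≤ p → 0ℚ ≤ q → d ≤ q * p → (c ÷ₛ p) * (d ÷ₛ c) ≤ q
÷ₛ-*-÷ₛ-≤ c d {p} {q} 0≤p 0≤q d≤qp = byCases (c ℚP.≟ 0ℚ) (p ℚP.≟ 0ℚ)
  where
  byCases : Dec (c ≡ 0ℚ) → Dec (p ≡ 0ℚ) → (c ÷ₛ p) * (d ÷ₛ c) ≤ q
  byCases (yes c≡0) _ = ℚP.≤-trans (ℚP.≤-reflexive (trans (cong ((c ÷ₛ p) *_) (÷ₛ-zeroʳ d c≡0))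
                                                          (ℚP.*-zeroʳ (c ÷ₛ p)))) 0≤q
  byCases (no _) (yes p≡0) = ℚP.≤-trans (ℚP.≤-reflexive (trans (cong (_* (d ÷ₛ c)) (÷ₛ-zeroʳ c p≡0))
                                                            (ℚP.*-zeroˡ (d ÷ₛ c)))) 0≤q
  byCases (no c≢0) (no p≢0) = ℚP.*-cancelʳ-≤-pos p {{p>0}} (ℚP.≤-trans (ℚP.≤-reflexive cancelled) d≤qp)
    where
    instance
      c≠0 : ℚ.NonZero c
      c≠0 = ℚ.≢-nonZero c≢0
      p≠0 : ℚ.NonZero p
      p≠0 = ℚ.≢-nonZero p≢0
    p>0 : ℚ.Positive p
    p>0 = ℚP.nonNeg∧nonZero⇒pos p {{ℚ.nonNegative 0≤p}}
    cancelled : (c ÷ₛ p) * (d ÷ₛ c) * p ≡ d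
    cancelled = begin
      (c ÷ₛ p) * (d ÷ₛ c) * p          ≡⟨ cong₂ (λ x y → x * y * p) (÷ₛ-≢0 c p≢0) (÷ₛ-≢0 d c≢0) ⟩
      c * 1/ p * (d * 1/ c) * p        ≡⟨ solve 5 (λ c p′ d c′ p → c :* p′ :* (d :* c′) :* p := d :* (c :* c′ :* (p′ :* p)))
                                            refl c (1/ p) d (1/ c) p ⟩
      d * (c * 1/ c * (1/ p * p))      ≡⟨ cong₂ (λ x y → d * (x * y)) (ℚP.*-inverseʳ c) (ℚP.*-inverseˡ p) ⟩
      d * (1ℚ * 1ℚ)                    ≡⟨ ℚP.*-identityʳ d ⟩
      d                                ∎
      where open ≡-Reasoning

sumFin-cong : ∀ {k} {f g : Fin k → ℕ} → (∀ i → f i ≡ g i) → sumFin f ≡ sumFin g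
sumFin-cong {zero}  f≗g = refl
sumFin-cong {suc k} f≗g = cong₂ ℕ._+_ (f≗g Fin.zero) (sumFin-cong (f≗g ∘ Fin.suc))

sumFin-+ : ∀ {k} (f g : Fin k → ℕ) → sumFin (λ i → f i ℕ.+ g i) ≡ sumFin f ℕ.+ sumFin g
sumFin-+ {zero}  f g = refl
sumFin-+ {suc k} f g = trans (cong (f Fin.zero ℕ.+ g Fin.zero ℕ.+_) (sumFin-+ (f ∘ Fin.suc) (g ∘ Fin.suc)))
                             (interchange (f Fin.zero) (g Fin.zero) _ _)

sumFin-zero : ∀ {k} {f : Fin k → ℕ} → (∀ i → f i ≡ 0) → sumFin f ≡ 0
sumFin-zero {zero}  f≗0 = refl
sumFin-zero {suc k} f≗0 = cong₂ ℕ._+_ (f≗0 Fin.zero) (sumFin-zero (f≗0 ∘ Fin.suc))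

sumFin-≤ : ∀ {k} (f : Fin k → ℕ) i → f i ℕ.≤ sumFin f
sumFin-≤ f Fin.zero    = ℕP.m≤m+n _ _
sumFin-≤ f (Fin.suc i) = ℕP.≤-trans (sumFin-≤ (f ∘ Fin.suc) i) (ℕP.m≤n+m _ _)

countFin-cong : ∀ {k} {P Q : Fin k → Bool} → (∀ i → P i ≡ Q i) → countFin P ≡ countFin Q
countFin-cong P≗Q = sumFin-cong (cong (if_then 1 else 0) ∘ P≗Q)

countFin-false : ∀ {k} {P : Fin k → Bool} → (∀ i → P i ≡ false) → countFin P ≡ 0
countFin-false P≗false = sumFin-zero (cong (if_then 1 else 0) ∘ P≗false)

countFin-true : ∀ {k} {P : Fin k → Bool} i → P i ≡ true → 1 ℕ.≤ countFin P
countFin-true {P = P} i Pi = ℕP.≤-trans (ℕP.≤-reflexive (cong (if_then 1 else 0) (sym Pi)))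
                                       (sumFin-≤ (λ j → if P j then 1 else 0) i)

countFin-≟ : ∀ {k} (a : Fin k) → countFin (λ j → does (a ≟ j)) ≡ 1
countFin-≟ {suc k} Fin.zero    = cong suc (sumFin-zero {k} (λ _ → refl))
countFin-≟ {suc k} (Fin.suc a) = countFin-≟ {k} a

countFin-≟-∧ : ∀ {k} (a : Fin k) b → countFin (λ j → does (a ≟ j) ∧ b) ≡ (if b then 1 else 0)
countFin-≟-∧ a true  = trans (countFin-cong {Q = λ j → does (a ≟ j)} (λ j → BoolP.∧-identityʳ _)) (countFin-≟ a)
countFin-≟-∧ a false = countFin-false {P = λ j → does (a ≟ j) ∧ false} (λ j → BoolP.∧-zeroʳ _)

countFin-∨ : ∀ {k} {P Q : Fin k → Bool} → (∀ i → P i ∧ Q i ≡ false) →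
             countFin (λ i → P i ∨ Q i) ≡ countFin P ℕ.+ countFin Q
countFin-∨ {P = P} {Q} disjoint = trans (sumFin-cong pointwise) (sumFin-+ (λ i → if P i then 1 else 0) (λ i → if Q i then 1 else 0))
  where
  pointwise : ∀ i → (if P i ∨ Q i then 1 else 0) ≡ (if P i then 1 else 0) ℕ.+ (if Q i then 1 else 0)
  pointwise i with P i | Q i | disjoint i
  ... | true  | false | _ = refl
  ... | false | true  | _ = refl
  ... | false | false | _ = refl

countFin-≟-∨ : ∀ {k} (a b : Fin k) → countFin (λ j → does (a ≟ j) ∨ does (b ≟ j)) ≡ (if does (a ≟ b) then 1 else 2)
countFin-≟-∨ a b with a ≟ b
... | yes refl = trans (countFin-cong {Q = λ j → does (a ≟ j)} (λ j → BoolP.∨-idem _)) (countFin-≟ a)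
... | no a≢b   = trans (countFin-∨ disjoint) (cong₂ ℕ._+_ (countFin-≟ a) (countFin-≟ b))
  where
  disjoint : ∀ j → does (a ≟ j) ∧ does (b ≟ j) ≡ false
  disjoint j with a ≟ j | b ≟ j
  ... | yes a≡j | yes b≡j = ⊥-elim (a≢b (trans a≡j (sym b≡j)))
  ... | yes _   | no _    = refl
  ... | no _    | _       = refl

module ∑ = CommutativeMonoidSum ℚP.+-0-commutativeMonoid

sumFinℚ≡∑ : ∀ {k} (f : Fin k → ℚ) → sumFinℚ f ≡ ∑.sum f
sumFinℚ≡∑ {zero}  f = refl
sumFinℚ≡∑ {suc k} f = cong (_+_ (f Fin.zero)) (sumFinℚ≡∑ (f ∘ Fin.suc))

sumFinℚ-cong : ∀ {k} {f g : Fin k → ℚ} → (∀ i → f i ≡ g i) → sumFinℚ f ≡ sumFinℚ g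
sumFinℚ-cong {zero}  f≗g = refl
sumFinℚ-cong {suc k} f≗g = cong₂ _+_ (f≗g Fin.zero) (sumFinℚ-cong (f≗g ∘ Fin.suc))

sumFinℚ-+ : ∀ {k} (f g : Fin k → ℚ) → sumFinℚ (λ i → f i + g i) ≡ sumFinℚ f + sumFinℚ g
sumFinℚ-+ f g = begin
  sumFinℚ (λ i → f i + g i)   ≡⟨ sumFinℚ≡∑ (λ i → f i + g i) ⟩
  ∑.sum (λ i → f i + g i)     ≡⟨ ∑.∑-distrib-+ f g ⟩
  ∑.sum f + ∑.sum g           ≡⟨ cong₂ _+_ (sumFinℚ≡∑ f) (sumFinℚ≡∑ g) ⟨
  sumFinℚ f + sumFinℚ g       ∎
  where open ≡-Reasoning

sumFinℚ-swap : ∀ {m k} (f : Fin m → Fin k → ℚ) →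
               sumFinℚ (λ i → sumFinℚ (f i)) ≡ sumFinℚ (λ j → sumFinℚ (λ i → f i j))
sumFinℚ-swap f = begin
  sumFinℚ (λ i → sumFinℚ (f i))                ≡⟨ sumFinℚ-cong (λ i → sumFinℚ≡∑ (f i)) ⟩
  sumFinℚ (λ i → ∑.sum (f i))                  ≡⟨ sumFinℚ≡∑ (λ i → ∑.sum (f i)) ⟩
  ∑.sum (λ i → ∑.sum (f i))                    ≡⟨ ∑.∑-comm f ⟩
  ∑.sum (λ j → ∑.sum (λ i → f i j))            ≡⟨ sumFinℚ≡∑ (λ j → ∑.sum (λ i → f i j)) ⟨
  sumFinℚ (λ j → ∑.sum (λ i → f i j))          ≡⟨ sumFinℚ-cong (λ j → sumFinℚ≡∑ (λ i → f i j)) ⟨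
  sumFinℚ (λ j → sumFinℚ (λ i → f i j))        ∎
  where open ≡-Reasoning

sumFinℚ-reindex : ∀ {k} (σ : Fin k → Fin k) → (∀ i → σ (σ i) ≡ i) → (f : Fin k → ℚ) →
                  sumFinℚ (f ∘ σ) ≡ sumFinℚ f
sumFinℚ-reindex σ σ-invol f = begin
  sumFinℚ (f ∘ σ)   ≡⟨ sumFinℚ≡∑ (f ∘ σ) ⟩
  ∑.sum (f ∘ σ)     ≡⟨ ∑.sum-permute f (permutation σ σ σ-invol σ-invol) ⟨
  ∑.sum f           ≡⟨ sumFinℚ≡∑ f ⟨
  sumFinℚ f         ∎
  where open ≡-Reasoning

sumFinℚ-*ˡ : ∀ {k} c (f : Fin k → ℚ) → sumFinℚ (λ i → c * f i) ≡ c * sumFinℚ f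
sumFinℚ-*ˡ {zero}  c f = sym (ℚP.*-zeroʳ c)
sumFinℚ-*ˡ {suc k} c f = trans (cong (_+_ (c * f Fin.zero)) (sumFinℚ-*ˡ c (f ∘ Fin.suc)))
                               (sym (ℚP.*-distribˡ-+ c _ _))

sumFinℚ-*ʳ : ∀ {k} c (f : Fin k → ℚ) → sumFinℚ (λ i → f i * c) ≡ sumFinℚ f * c
sumFinℚ-*ʳ c f = trans (sumFinℚ-cong (λ i → ℚP.*-comm (f i) c))
                       (trans (sumFinℚ-*ˡ c f) (ℚP.*-comm c _))

sumFinℚ-mono : ∀ {k} {f g : Fin k → ℚ} → (∀ i → f i ≤ g i) → sumFinℚ f ≤ sumFinℚ g
sumFinℚ-mono {zero}  f≤g = ℚP.≤-refl
sumFinℚ-mono {suc k} f≤g = ℚP.+-mono-≤ (f≤g Fin.zero) (sumFinℚ-mono (f≤g ∘ Fin.suc))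

sumFinℚ-nonNeg : ∀ {k} {f : Fin k → ℚ} → (∀ i → 0ℚ ≤ f i) → 0ℚ ≤ sumFinℚ f
sumFinℚ-nonNeg {zero}  0≤f = ℚP.≤-refl
sumFinℚ-nonNeg {suc k} 0≤f = ℚP.+-mono-≤ (0≤f Fin.zero) (sumFinℚ-nonNeg (0≤f ∘ Fin.suc))

maxFinℚ-≤ : ∀ {k} (f : Fin k → ℚ) i → f i ≤ maxFinℚ f
maxFinℚ-≤ f Fin.zero    = ℚP.p≤p⊔q (f Fin.zero) _
maxFinℚ-≤ f (Fin.suc i) = ℚP.≤-trans (maxFinℚ-≤ (f ∘ Fin.suc) i) (ℚP.p≤q⊔p (f Fin.zero) _)

maxFinℚ-nonNeg : ∀ {k} {f : Fin k → ℚ} → (∀ i → 0ℚ ≤ f i) → 0ℚ ≤ maxFinℚ f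
maxFinℚ-nonNeg {zero}      0≤f = ℚP.≤-refl
maxFinℚ-nonNeg {suc k} {f} 0≤f = ℚP.≤-trans (0≤f Fin.zero) (maxFinℚ-≤ f Fin.zero)

ι-sumFin : ∀ {k} (f : Fin k → ℕ) → ι (sumFin f) ≡ sumFinℚ (ι ∘ f)
ι-sumFin {zero}  f = refl
ι-sumFin {suc k} f = trans (ι-+ (f Fin.zero) _) (cong (_+_ (ι (f Fin.zero))) (ι-sumFin (f ∘ Fin.suc)))

ι-countFin : ∀ {k} (P : Fin k → Bool) → ι (countFin P) ≡ sumFinℚ (χ ∘ P)
ι-countFin P = trans (ι-sumFin (λ i → if P i then 1 else 0)) (sumFinℚ-cong (λ i → ι-if (P i)))
  where
  ι-if : ∀ b → ι (if b then 1 else 0) ≡ χ b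
  ι-if true  = refl
  ι-if false = refl

χ-∧ : ∀ a b → χ (a ∧ b) ≡ χ a * χ b
χ-∧ true  b = sym (ℚP.*-identityˡ (χ b))
χ-∧ false b = sym (ℚP.*-zeroˡ (χ b))

χ-nonNeg : ∀ b → 0ℚ ≤ χ b
χ-nonNeg true  = ℚP.nonNegative⁻¹ 1ℚ
χ-nonNeg false = ℚP.≤-refl

χ-mono : ∀ {a b} → (T a → T b) → χ a ≤ χ b
χ-mono {false} {b}     _   = χ-nonNeg b
χ-mono {true}  {true}  _   = ℚP.≤-refl
χ-mono {true}  {false} a⇒b = ⊥-elim (a⇒b _)

recipℕ-nonNeg : ∀ k → 0ℚ ≤ recipℕ k
recipℕ-nonNeg zero    = ℚP.≤-refl
recipℕ-nonNeg (suc k) = /-nonNeg 1 (suc k)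

-- Orbits of an involution of Fin N

module Involution {N : ℕ} (σ : Fin N → Fin N) (σ-invol : ∀ v → σ (σ v) ≡ v) where

  isOrbitRep : Fin N → Bool
  isOrbitRep v = not (toℕ (σ v) <ᵇ toℕ v)

  orbitSize : Fin N → ℕ
  orbitSize v = if does (σ v ≟ v) then 1 else 2

  -- An orbit of size 2 has exactly one representative, an orbit of size 1 is its own.
  ½-χ-isOrbitRep : ∀ v → ½ * (χ (isOrbitRep v) + χ (isOrbitRep (σ v))) ≡ recipℕ (orbitSize v)
  ½-χ-isOrbitRep v rewrite σ-invol v with FinP.<-cmp v (σ v)
  ... | tri< v<σv v≢σv _
    rewrite dec-false (toℕ (σ v) ℕP.<? toℕ v) (ℕP.<-asym v<σv)
          | dec-true (toℕ v ℕP.<? toℕ (σ v)) v<σv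
          | dec-false (σ v ≟ v) (v≢σv ∘ sym) = refl
  ... | tri≈ _ v≡σv _ rewrite sym v≡σv | <ᵇ-irrefl (toℕ v) | dec-true (v ≟ v) refl = refl
  ... | tri> _ v≢σv σv<v
    rewrite dec-true (toℕ (σ v) ℕP.<? toℕ v) σv<v
          | dec-false (toℕ v ℕP.<? toℕ (σ v)) (ℕP.<-asym σv<v)
          | dec-false (σ v ≟ v) (v≢σv ∘ sym) = refl

  -- Reindexing by σ counts every orbit once through each of its points.
  ∑-isOrbitRep : (g : Fin N → ℚ) → (∀ v → g (σ v) ≡ g v) →
                 sumFinℚ (λ v → χ (isOrbitRep v) * g v) ≡ sumFinℚ (λ v → recipℕ (orbitSize v) * g v)
  ∑-isOrbitRep g g∘σ≗g = begin
    sumFinℚ rep·g                                    ≡⟨ solve 1 (λ x → con ½ :* (x :+ x) := x) refl (sumFinℚ rep·g) ⟨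
    ½ * (sumFinℚ rep·g + sumFinℚ rep·g)              ≡⟨ cong (λ t → ½ * (sumFinℚ rep·g + t)) reindexed ⟩
    ½ * (sumFinℚ rep·g + sumFinℚ rep∘σ·g)            ≡⟨ cong (½ *_) (sumFinℚ-+ rep·g rep∘σ·g) ⟨
    ½ * sumFinℚ (λ v → rep·g v + rep∘σ·g v)          ≡⟨ sumFinℚ-*ˡ ½ (λ v → rep·g v + rep∘σ·g v) ⟨
    sumFinℚ (λ v → ½ * (rep·g v + rep∘σ·g v))        ≡⟨ sumFinℚ-cong regroup ⟩
    sumFinℚ (λ v → recipℕ (orbitSize v) * g v)       ∎
    where
    open ≡-Reasoning
    rep·g rep∘σ·g : Fin N → ℚ
    rep·g v   = χ (isOrbitRep v) * g v
    rep∘σ·g v = χ (isOrbitRep (σ v)) * g v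
    reindexed : sumFinℚ rep·g ≡ sumFinℚ rep∘σ·g
    reindexed = trans (sym (sumFinℚ-reindex σ σ-invol rep·g))
                      (sumFinℚ-cong (λ v → cong (χ (isOrbitRep (σ v)) *_) (g∘σ≗g v)))
    regroup : ∀ v → ½ * (rep·g v + rep∘σ·g v) ≡ recipℕ (orbitSize v) * g v
    regroup v = trans (solve 3 (λ a b x → con ½ :* (a :* x :+ b :* x) := con ½ :* (a :+ b) :* x)
                             refl (χ (isOrbitRep v)) (χ (isOrbitRep (σ v))) (g v))
                      (cong (_* g v) (½-χ-isOrbitRep v))

-- The classes of ∼_E

module _ {n : ℕ} (Γ : IndexedMultigraph n) where

  module Edges (ℓ : Fin n) = Involution (λ v → E Γ v ℓ) (λ v → invol Γ v ℓ)

  ∼E-inv : ∀ {w k v ℓ} → _∼E_ Γ (w , k) (v , ℓ) → k ≡ ℓ × (w ≡ E Γ v ℓ ⊎ w ≡ v)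
  ∼E-inv {w} {k} (refl , inj₁ Ewk≡v) = refl , inj₁ (trans (sym (invol Γ w k)) (cong (λ x → E Γ x k) Ewk≡v))
  ∼E-inv         (refl , inj₂ w≡v)   = refl , inj₂ w≡v

  <lex-sameIndex : ∀ w v ℓ → _<lex_ Γ (w , ℓ) (v , ℓ) ≡ (toℕ w <ᵇ toℕ v)
  <lex-sameIndex w v ℓ rewrite <ᵇ-irrefl (toℕ ℓ) | BoolP.∧-zeroʳ ⌊ w ≟ v ⌋ = BoolP.∨-identityʳ _

  isRep≡isOrbitRep : ∀ v ℓ → isRep Γ v ℓ ≡ Edges.isOrbitRep ℓ v
  isRep≡isOrbitRep v ℓ with toℕ (E Γ v ℓ) <ᵇ toℕ v in Evℓ<v
  ... | false = cong (ℕ._≡ᵇ 0) (sumFin-zero (λ w → countFin-false (noSmallerClassmate w)))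
    where
    noSmallerClassmate : ∀ w k → (_<lex_ Γ (w , k) (v , ℓ) ∧ ⌊ ∼E? Γ (w , k) (v , ℓ) ⌋) ≡ false
    noSmallerClassmate w k with ∼E? Γ (w , k) (v , ℓ)
    ... | no _ = BoolP.∧-zeroʳ _
    ... | yes w∼v with ∼E-inv w∼v
    ...   | refl , inj₁ refl = cong (_∧ true) (trans (<lex-sameIndex (E Γ v ℓ) v ℓ) Evℓ<v)
    ...   | refl , inj₂ refl = cong (_∧ true) (trans (<lex-sameIndex v v ℓ) (<ᵇ-irrefl (toℕ v)))
  ... | true = ≡ᵇ0-false (ℕP.≤-trans (countFin-true ℓ smallerClassmate) (sumFin-≤ _ (E Γ v ℓ)))
    where
    smallerClassmate : (_<lex_ Γ (E Γ v ℓ , ℓ) (v , ℓ) ∧ ⌊ ∼E? Γ (E Γ v ℓ , ℓ) (v , ℓ) ⌋) ≡ true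
    smallerClassmate = cong₂ _∧_ (trans (<lex-sameIndex (E Γ v ℓ) v ℓ) Evℓ<v)
                                 (trans (isYes≗does _) (dec-true (∼E? Γ (E Γ v ℓ , ℓ) (v , ℓ)) (refl , inj₁ (invol Γ v ℓ))))

  classSize≡orbitSize : ∀ v ℓ → classSize Γ v ℓ ≡ Edges.orbitSize ℓ v
  classSize≡orbitSize v ℓ = begin
    classSize Γ v ℓ                                                  ≡⟨ sumFin-cong (λ w → countFin-cong (λ k → isYes≗does (∼E? Γ (v , ℓ) (w , k)))) ⟩
    sumFin (λ w → countFin (λ k → does (ℓ ≟ k) ∧ (does (E Γ v ℓ ≟ w) ∨ does (v ≟ w))))
                                                                     ≡⟨ sumFin-cong (λ w → countFin-≟-∧ ℓ (does (E Γ v ℓ ≟ w) ∨ does (v ≟ w))) ⟩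
    countFin (λ w → does (E Γ v ℓ ≟ w) ∨ does (v ≟ w))                ≡⟨ countFin-≟-∨ (E Γ v ℓ) v ⟩
    Edges.orbitSize ℓ v                                              ∎
    where open ≡-Reasoning

  M-nonNeg : 0ℚ ≤ M Γ
  M-nonNeg = maxFinℚ-nonNeg (λ v → sumFinℚ-nonNeg (λ ℓ → recipℕ-nonNeg (classSize Γ v ℓ)))

-- Differing classes versus differing vertices

module _ (F : FiniteField) {n : ℕ} (Γ : IndexedMultigraph n) (f f' : W Γ F) where
  open FiniteField F using () renaming (_≟_ to _≟F_)
  open W

  differsAt : Fin (numV Γ) → Fin n → Bool
  differsAt v ℓ = not ⌊ fun f v ℓ ≟F fun f' v ℓ ⌋

  differsAt-E : ∀ v ℓ → differsAt (E Γ v ℓ) ℓ ≡ differsAt v ℓ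
  differsAt-E v ℓ = cong₂ (λ x y → not ⌊ x ≟F y ⌋) (const f _ _ ℓ classmates) (const f' _ _ ℓ classmates)
    where
    classmates : _∼E_ Γ (E Γ v ℓ , ℓ) (v , ℓ)
    classmates = refl , inj₁ (invol Γ v ℓ)

  differsAt⇒vertexDiffers : ∀ v ℓ → T (differsAt v ℓ) → T (vertexDiffers Γ f f' v)
  differsAt⇒vertexDiffers v ℓ fvℓ≢f'vℓ = fromWitnessFalse λ fv≡f'v →
    toWitnessFalse fvℓ≢f'vℓ (begin
      fun f v ℓ                               ≡⟨ VecP.lookup∘tabulate (fun f v) ℓ ⟨
      Vec.lookup (Vec.tabulate (fun f v)) ℓ   ≡⟨ cong (λ t → Vec.lookup t ℓ) fv≡f'v ⟩
      Vec.lookup (Vec.tabulate (fun f' v)) ℓ  ≡⟨ VecP.lookup∘tabulate (fun f' v) ℓ ⟩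
      fun f' v ℓ                              ∎)
    where open ≡-Reasoning

  ∑-differsAt≤ : ∀ v → sumFinℚ (λ ℓ → recipℕ (classSize Γ v ℓ) * χ (differsAt v ℓ))
                         ≤ χ (vertexDiffers Γ f f' v) * M Γ
  ∑-differsAt≤ v = begin
    sumFinℚ (λ ℓ → r ℓ * χ (differsAt v ℓ))   ≤⟨ sumFinℚ-mono (λ ℓ → ℚP.*-monoˡ-≤-nonNeg (r ℓ) {{ℚ.nonNegative (recipℕ-nonNeg (classSize Γ v ℓ))}}
                                                   (χ-mono (differsAt⇒vertexDiffers v ℓ))) ⟩
    sumFinℚ (λ ℓ → r ℓ * χ vd)                 ≡⟨ sumFinℚ-*ʳ (χ vd) r ⟩
    sumFinℚ r * χ vd                           ≤⟨ ℚP.*-monoʳ-≤-nonNeg (χ vd) {{ℚ.nonNegative (χ-nonNeg vd)}}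
                                                   (maxFinℚ-≤ (λ w → sumFinℚ (λ ℓ → recipℕ (classSize Γ w ℓ))) v) ⟩
    M Γ * χ vd                                 ≡⟨ ℚP.*-comm (M Γ) (χ vd) ⟩
    χ vd * M Γ                                 ∎
    where
    open ℚP.≤-Reasoning
    r : Fin n → ℚ
    r ℓ = recipℕ (classSize Γ v ℓ)
    vd : Bool
    vd = vertexDiffers Γ f f' v

  numDiffClasses≤ : ι (numDiffClasses Γ f f') ≤ ι (countFin (vertexDiffers Γ f f')) * M Γ
  numDiffClasses≤ = begin
    ι (countPairs Γ repDiffers)                                      ≡⟨ ι-sumFin (λ v → countFin (repDiffers v)) ⟩
    sumFinℚ (λ v → ι (countFin (repDiffers v)))                     ≡⟨ sumFinℚ-cong (λ v → ι-countFin (repDiffers v)) ⟩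
    sumFinℚ (λ v → sumFinℚ (λ ℓ → χ (repDiffers v ℓ)))              ≡⟨ sumFinℚ-swap (λ v ℓ → χ (repDiffers v ℓ)) ⟩
    sumFinℚ (λ ℓ → sumFinℚ (λ v → χ (repDiffers v ℓ)))              ≡⟨ sumFinℚ-cong (λ ℓ → sumFinℚ-cong (χ-repDiffers ℓ)) ⟩
    sumFinℚ (λ ℓ → sumFinℚ (λ v → χ (Edges.isOrbitRep Γ ℓ v) * χ (differsAt v ℓ)))
                                                                     ≡⟨ sumFinℚ-cong (λ ℓ → Edges.∑-isOrbitRep Γ ℓ (λ v → χ (differsAt v ℓ))
                                                                                                (λ v → cong χ (differsAt-E v ℓ))) ⟩
    sumFinℚ (λ ℓ → sumFinℚ (λ v → recipℕ (Edges.orbitSize Γ ℓ v) * χ (differsAt v ℓ)))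
                                                                     ≡⟨ sumFinℚ-cong (λ ℓ → sumFinℚ-cong (λ v →
                                                                          cong (λ k → recipℕ k * χ (differsAt v ℓ)) (classSize≡orbitSize Γ v ℓ))) ⟨
    sumFinℚ (λ ℓ → sumFinℚ (λ v → weighted v ℓ))                    ≡⟨ sumFinℚ-swap weighted ⟨
    sumFinℚ (λ v → sumFinℚ (weighted v))                            ≤⟨ sumFinℚ-mono ∑-differsAt≤ ⟩
    sumFinℚ (λ v → χ (vertexDiffers Γ f f' v) * M Γ)                ≡⟨ sumFinℚ-*ʳ (M Γ) (χ ∘ vertexDiffers Γ f f') ⟩
    sumFinℚ (χ ∘ vertexDiffers Γ f f') * M Γ                         ≡⟨ cong (_* M Γ) (ι-countFin (vertexDiffers Γ f f')) ⟨
    ι (countFin (vertexDiffers Γ f f')) * M Γ                        ∎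
    where
    open ℚP.≤-Reasoning
    repDiffers : Fin (numV Γ) → Fin n → Bool
    repDiffers v ℓ = isRep Γ v ℓ ∧ differsAt v ℓ
    weighted : Fin (numV Γ) → Fin n → ℚ
    weighted v ℓ = recipℕ (classSize Γ v ℓ) * χ (differsAt v ℓ)
    χ-repDiffers : ∀ ℓ v → χ (repDiffers v ℓ) ≡ χ (Edges.isOrbitRep Γ ℓ v) * χ (differsAt v ℓ)
    χ-repDiffers ℓ v = trans (χ-∧ (isRep Γ v ℓ) (differsAt v ℓ))
                             (cong (λ b → χ b * χ (differsAt v ℓ)) (isRep≡isOrbitRep Γ v ℓ))

mainTheorem1 : (F : FiniteField) (n : ℕ) → .{{NonZero n}} → (Γ : IndexedMultigraph n) →
    .{{_ : NonZero (numV Γ)}} → (f f' : W Γ F) →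
    ((+ numClasses Γ ℚ./ 1) ÷ₛ (M Γ * (+ numV Γ ℚ./ 1))) * ΔH Γ f f' ≤ ΔV Γ f f'
mainTheorem1 F n Γ f f' =
  ÷ₛ-*-÷ₛ-≤ (ι (numClasses Γ)) (ι (numDiffClasses Γ f f')) 0≤M·|V| (/-nonNeg K |V|)
    (subst (ι (numDiffClasses Γ f f') ≤_) rescale (numDiffClasses≤ F Γ f f'))
  where
  |V| K : ℕ
  |V| = numV Γ
  K = countFin (vertexDiffers Γ f f')
  0≤M·|V| : 0ℚ ≤ M Γ * ι |V|
  0≤M·|V| = ℚP.nonNegative⁻¹ _ {{ℚP.nonNeg*nonNeg⇒nonNeg (M Γ) {{ℚ.nonNegative (M-nonNeg Γ)}}
                                                      (ι |V|) {{ℚP.normalize-nonNeg |V| 1}}}}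
  rescale : ι K * M Γ ≡ (+ K ℚ./ |V|) * (M Γ * ι |V|)
  rescale = begin
    ι K * M Γ                        ≡⟨ cong (_* M Γ) (/-*-cancel K |V|) ⟨
    (+ K ℚ./ |V|) * ι |V| * M Γ      ≡⟨ solve 3 (λ q x m → q :* x :* m := q :* (m :* x)) refl (+ K ℚ./ |V|) (ι |V|) (M Γ) ⟩
    (+ K ℚ./ |V|) * (M Γ * ι |V|)    ∎
    where open ≡-Reasoning
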